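{- Let $p$ be a prime, $a,b,c,d\in\mathbb{Z}$, $l,h,k,i\in\mathbb{N}$, with $(p,a)=(p,b)=1$. Let $H$ be the number of integers $x$ with $1\le x\le p^h$ and $p^i\mid c+dx$ satisfying $$a\Big(\frac{c+dx}{p^i}\Big)^k+b\equiv0\pmod{p^l}.$$ Then $H\ll_k(d,p^l)\max(1,p^{h-l})$.
   Context: $(d,p^l)$ denotes the gcd; $\ll_k$ means the implied constant depends only on $k$. -}

module Defs where

open import Data.Nat as ℕ using (ℕ)
open import Data.Integer as ℤ using (ℤ; +_)
open import Data.Integer.Divisibility using (_∣_)
open import Data.Product using (Σ; _×_)
open import Relation.Binary.PropositionalEquality using (_≡_)

-- Sat p a b c d l i k x :  p^i ∣ c + d x  and, writing y = (c + d x)/p^i,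
--   a y^k + b ≡ 0 (mod p^l).
-- The exact quotient y is given as a witness (it is unique since p^i ≠ 0).
Sat : (p : ℕ) (a b c d : ℤ) (l i k : ℕ) (x : ℕ) → Set
Sat p a b c d l i k x =
  Σ ℤ (λ y → (c ℤ.+ d ℤ.* (+ x) ≡ (+ (p ℕ.^ i)) ℤ.* y)
           × ((+ (p ℕ.^ l)) ∣ (a ℤ.* (y ℤ.^ k) ℤ.+ b)))

{-# OPTIONS --safe #-}
-- Write y = (c + d x) / p^i. Since p ∤ ab, every such y with l ≥ 1 is a unit solving
-- a y^k + b ≡ 0 mod p^l. Sort these y into classes mod q, where q = p for odd p and q = 4
-- for p = 2: Lagrange's theorem (resp. counting odd residues mod 4) leaves at most 2k classes.
-- Within a class, y^k ≡ y'^k mod p^l and lifting the exponent through the factors p of k give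
-- y ≡ y' mod p^(l-w) with p^w ≤ k, so a class meets at most k residues mod p^l. Hence y takes
-- at most 2k² values mod p^l. Fixing y mod p^l fixes d x mod p^(i+l), hence x modulo
-- p^l / (d, p^l), and [1, p^h] contains at most (d, p^l) max(1, p^(h-l)) such x.
module Submission where

module Counting where

  open import Data.Nat using (ℕ; zero; suc; _+_; _*_; _≤_; _<_; z≤n; s≤s; NonZero)
  open import Data.Nat.Properties
    using (+-suc; +-mono-≤; ≤-pred; ≤∧≢⇒<; _≟_; module ≤-Reasoning)
  open import Data.Nat.DivMod using (_/_; _%_; m≡m%n+[m/n]*n; m<n*o⇒m/o<n)
  open import Data.List using (List; []; _∷_; length; filter; map)
  open import Data.List.Properties using (length-map)
  open import Data.List.Relation.Unary.All as All using (All; []; _∷_)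
  open import Data.List.Relation.Unary.All.Properties as All using (all-filter)
  open import Data.List.Relation.Unary.AllPairs as AllPairs using (AllPairs; []; _∷_)
  import Data.List.Relation.Unary.AllPairs.Properties as AllPairs
  open import Data.List.Relation.Unary.Unique.Propositional using (Unique)
  open import Data.Product using (_×_; _,_; proj₁; proj₂)
  open import Data.Empty using (⊥-elim)
  open import Relation.Nullary using (¬_; Dec; yes; no)
  open import Level using (0ℓ)
  open import Relation.Unary using (Pred; Decidable)
  open import Relation.Unary.Properties using (∁?)
  open import Relation.Binary using (Rel; IsPartialEquivalence)
  open import Relation.Binary.PropositionalEquality
    using (_≡_; refl; sym; trans; cong; cong₂; module ≡-Reasoning)

  module _ {A : Set} where

    length-filter+filter∁ : {P : Pred A 0ℓ} (P? : Decidable P) (xs : List A) →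
      length xs ≡ length (filter P? xs) + length (filter (∁? P?) xs)
    length-filter+filter∁ P? [] = refl
    length-filter+filter∁ P? (x ∷ xs) with P? x
    ... | yes _ = cong suc (length-filter+filter∁ P? xs)
    ... | no _  = trans (cong suc (length-filter+filter∁ P? xs)) (sym (+-suc _ _))

    module _ {P : Pred A 0ℓ} {R : Rel A 0ℓ} {S : Rel A 0ℓ}
             (P∧R⇒S : ∀ {x y} → P x → P y → R x y → S x y) where

      AllPairs-weaken : ∀ {xs} → All P xs → AllPairs R xs → AllPairs S xs
      AllPairs-weaken [] [] = []
      AllPairs-weaken (px ∷ pxs) (rx ∷ rxs) = go pxs rx ∷ AllPairs-weaken pxs rxs
        where
        go : ∀ {ys} → All P ys → All (R _) ys → All (S _) ys
        go [] [] = []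
        go (py ∷ pys) (r ∷ rs) = P∧R⇒S px py r ∷ go pys rs

    length-reduce : {P : Pred A 0ℓ} {B : Set} (f : ∀ {x} → P x → B) {xs : List A} (pxs : All P xs) →
      length (All.reduce f pxs) ≡ length xs
    length-reduce f [] = refl
    length-reduce f (_ ∷ pxs) = cong suc (length-reduce f pxs)

    All-reduce⁺ : {P : Pred A 0ℓ} {B : Set} {Q : Pred B 0ℓ} (f : ∀ {x} → P x → B) →
      (∀ {x} (px : P x) → Q (f px)) → ∀ {xs} (pxs : All P xs) → All Q (All.reduce f pxs)
    All-reduce⁺ f P⇒Q [] = []
    All-reduce⁺ f P⇒Q (px ∷ pxs) = P⇒Q px ∷ All-reduce⁺ f P⇒Q pxs

    AllPairs-reduce⁺ : {P : Pred A 0ℓ} {R : Rel A 0ℓ} {B : Set} {S : Rel B 0ℓ} (f : ∀ {x} → P x → B) →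
      (∀ {x y} (px : P x) (py : P y) → R x y → S (f px) (f py)) →
      ∀ {xs} (pxs : All P xs) → AllPairs R xs → AllPairs S (All.reduce f pxs)
    AllPairs-reduce⁺ f R⇒S [] [] = []
    AllPairs-reduce⁺ {P = P} {R} {S = S} f R⇒S (px ∷ pxs) (rx ∷ rxs) =
      go pxs rx ∷ AllPairs-reduce⁺ f R⇒S pxs rxs
      where
      go : ∀ {ys} (pys : All P ys) → All (R _) ys → All (S (f px)) (All.reduce f pys)
      go [] [] = []
      go (py ∷ pys) (r ∷ rs) = R⇒S px py r ∷ go pys rs

    AllPairs-∷-class : {E : Rel A 0ℓ} → IsPartialEquivalence E →
      ∀ {x ys} → All (E x) ys → AllPairs E (x ∷ ys)
    AllPairs-∷-class {E = E} isPE {x} Exys = Exys ∷ go Exys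
      where
      open IsPartialEquivalence isPE renaming (sym to E-sym; trans to E-trans)
      go : ∀ {ys} → All (E x) ys → AllPairs E ys
      go [] = []
      go (Exy ∷ Exys) = All.map (E-trans (E-sym Exy)) Exys ∷ go Exys

    length≤classes*classSize : {E : Rel A 0ℓ} (E? : ∀ x y → Dec (E x y)) → IsPartialEquivalence E →
      {P : Pred A 0ℓ} {D : Rel A 0ℓ} (R B : ℕ) →
      (∀ ys → All P ys → AllPairs (λ x y → ¬ E x y) ys → length ys ≤ R) →
      (∀ ys → All P ys → AllPairs D ys → AllPairs E ys → length ys ≤ B) →
      ∀ xs → All P xs → AllPairs D xs → length xs ≤ R * B
    length≤classes*classSize E? isPE R B classes classSize [] _ _ = z≤n
    length≤classes*classSize E? isPE zero B classes classSize (x ∷ xs) (px ∷ _) _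
      with () ← classes (x ∷ []) (px ∷ []) ([] ∷ [])
    length≤classes*classSize {E = E} E? isPE {P} {D} (suc R) B classes classSize
      (x ∷ xs) (px ∷ pxs) (Dx ∷ Dxs) = begin
        length (x ∷ xs)                 ≡⟨ cong suc (length-filter+filter∁ (E? x) xs) ⟩
        suc (length ins) + length outs  ≤⟨ +-mono-≤ ins≤B outs≤R*B ⟩
        B + R * B                       ∎
      where
      open ≤-Reasoning
      ins = filter (E? x) xs
      outs = filter (∁? (E? x)) xs
      ins≤B : suc (length ins) ≤ B
      ins≤B = classSize (x ∷ ins) (px ∷ All.filter⁺ (E? x) pxs)
                (All.filter⁺ (E? x) Dx ∷ AllPairs.filter⁺ (E? x) Dxs)
                (AllPairs-∷-class isPE (all-filter (E? x) xs))
      P′ : Pred A 0ℓ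
      P′ z = P z × ¬ E x z
      outs≤R*B : length outs ≤ R * B
      outs≤R*B = length≤classes*classSize E? isPE {P′} R B
        (λ ys pys ¬Eys → ≤-pred (classes (x ∷ ys) (px ∷ All.map proj₁ pys) (All.map proj₂ pys ∷ ¬Eys)))
        (λ ys pys → classSize ys (All.map proj₁ pys))
        outs (All.zip (All.filter⁺ (∁? (E? x)) pxs , all-filter (∁? (E? x)) xs))
        (AllPairs.filter⁺ (∁? (E? x)) Dxs)

  unique-constant-length≤1 : ∀ {v : ℕ} ns → Unique ns → All (_≡ v) ns → length ns ≤ 1
  unique-constant-length≤1 [] _ _ = z≤n
  unique-constant-length≤1 (_ ∷ []) _ _ = s≤s z≤n
  unique-constant-length≤1 (_ ∷ _ ∷ _) ((x≢y ∷ _) ∷ _) (refl ∷ refl ∷ _) = ⊥-elim (x≢y refl)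

  unique-below-length≤ : ∀ K ns → Unique ns → All (_< K) ns → length ns ≤ K
  unique-below-length≤ zero [] _ _ = z≤n
  unique-below-length≤ zero (_ ∷ _) _ (() ∷ _)
  unique-below-length≤ (suc K) ns uniq below = begin
    length ns                                        ≡⟨ length-filter+filter∁ (_≟ K) ns ⟩
    length (filter (_≟ K) ns) + length rest           ≤⟨ +-mono-≤ hits≤1 rest≤K ⟩
    1 + K                                            ∎
    where
    open ≤-Reasoning
    rest = filter (∁? (_≟ K)) ns
    hits≤1 : length (filter (_≟ K) ns) ≤ 1
    hits≤1 = unique-constant-length≤1 _ (AllPairs.filter⁺ (_≟ K) uniq) (all-filter (_≟ K) ns)
    rest≤K : length rest ≤ K
    rest≤K = unique-below-length≤ K rest (AllPairs.filter⁺ (∁? (_≟ K)) uniq)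
      (All.map (λ (n<1+K , n≢K) → ≤∧≢⇒< (≤-pred n<1+K) n≢K)
        (All.zip (All.filter⁺ (∁? (_≟ K)) below , all-filter (∁? (_≟ K)) ns)))

  %∧/-injective : ∀ m .{{_ : NonZero m}} {u v} → u % m ≡ v % m → u / m ≡ v / m → u ≡ v
  %∧/-injective m {u} {v} %≡ /≡ = begin
    u                 ≡⟨ m≡m%n+[m/n]*n u m ⟩
    u % m + u / m * m ≡⟨ cong₂ (λ r q → r + q * m) %≡ /≡ ⟩
    v % m + v / m * m ≡⟨ m≡m%n+[m/n]*n v m ⟨
    v                 ∎
    where open ≡-Reasoning

  -- Their quotients by m are distinct and below K.
  sameRemainder-length≤ : ∀ m K .{{_ : NonZero m}} ns → Unique ns → All (_< K * m) ns →
    AllPairs (λ u v → u % m ≡ v % m) ns → length ns ≤ K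
  sameRemainder-length≤ m K ns uniq below same%
    rewrite sym (length-map (_/ m) ns) =
    unique-below-length≤ K (map (_/ m) ns)
      (AllPairs.map⁺ (AllPairs.zipWith (λ (u≢v , %≡) /≡ → u≢v (%∧/-injective m %≡ /≡)) (uniq , same%)))
      (All.map⁺ (All.map m<n*o⇒m/o<n below))


module Congruence where

  open import Data.Nat as ℕ using (ℕ; zero; suc; _≤_; _<_; NonZero)
  open import Data.Nat.Properties using (≤-antisym; ≤-total; m∸n≡0⇒m≤n; m∸n≤m; ≤-<-trans)
  import Data.Nat.Divisibility as ℕ
  open import Data.Integer using (ℤ; +_; -_; _+_; _-_; _*_; ∣_∣; _%ℕ_; _/ℕ_)
  open import Data.Integer.Properties using ([+m]-[+n]≡m⊖n; ⊖-≥; +-inverseʳ; *-identityʳ)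
  open import Data.Integer.DivMod using (n%ℕd<d; a≡a%ℕn+[a/ℕn]*n)
  open import Data.Integer.Divisibility.Signed
    using (_∣_; divides; _∣?_; ∣-trans; ∣m∣n⇒∣m+n; ∣m∣n⇒∣m-n; ∣m⇒∣-m; ∣ᵤ⇒∣; ∣⇒∣ᵤ)
  open import Data.Integer.Tactic.RingSolver using (solve-∀)
  open import Data.Sum using (inj₁; inj₂)
  open import Relation.Nullary using (Dec; contradiction)
  import Relation.Nullary.Decidable as Dec
  open import Relation.Binary using (IsEquivalence; IsPartialEquivalence)
  open import Relation.Binary.PropositionalEquality
    using (_≡_; refl; sym; trans; cong; subst; module ≡-Reasoning)

  infix 4 _≡_mod_ _≡?_mod_
  record _≡_mod_ (x y : ℤ) (m : ℕ) : Set where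
    constructor ∣⇒≡mod
    field ≡mod⇒∣ : + m ∣ x - y
  open _≡_mod_ public

  private variable
    m : ℕ
    x y z : ℤ

  mod-refl : ∀ x → x ≡ x mod m
  mod-refl x = ∣⇒≡mod (divides (+ 0) (+-inverseʳ x))

  mod-sym : x ≡ y mod m → y ≡ x mod m
  mod-sym {x = x} {y = y} (∣⇒≡mod x≡y) = ∣⇒≡mod (subst (_ ∣_) (neg-minus x y) (∣m⇒∣-m x≡y))
    where
    neg-minus : ∀ x y → - (x - y) ≡ y - x
    neg-minus = solve-∀

  mod-trans : x ≡ y mod m → y ≡ z mod m → x ≡ z mod m
  mod-trans {x = x} {y = y} {z = z} (∣⇒≡mod x≡y) (∣⇒≡mod y≡z) =
    ∣⇒≡mod (subst (_ ∣_) (telescope x y z) (∣m∣n⇒∣m+n x≡y y≡z))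
    where
    telescope : ∀ x y z → (x - y) + (y - z) ≡ x - z
    telescope = solve-∀

  mod-isEquivalence : IsEquivalence (λ x y → x ≡ y mod m)
  mod-isEquivalence = record { refl = mod-refl _ ; sym = mod-sym ; trans = mod-trans }

  mod-isPartialEquivalence : IsPartialEquivalence (λ x y → x ≡ y mod m)
  mod-isPartialEquivalence = IsEquivalence.isPartialEquivalence mod-isEquivalence

  _≡?_mod_ : ∀ x y m → Dec (x ≡ y mod m)
  x ≡? y mod m = Dec.map′ ∣⇒≡mod ≡mod⇒∣ (+ m ∣? (x - y))

  mod-∣ : ∀ {n} → n ℕ.∣ m → x ≡ y mod m → x ≡ y mod n
  mod-∣ n∣m (∣⇒≡mod x≡y) = ∣⇒≡mod (∣-trans (∣ᵤ⇒∣ n∣m) x≡y)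

  mod-1 : ∀ x y → x ≡ y mod 1
  mod-1 x y = ∣⇒≡mod (divides (x - y) (sym (*-identityʳ (x - y))))

  ∣-respʳ-≡mod : x ≡ y mod m → + m ∣ x → + m ∣ y
  ∣-respʳ-≡mod {x = x} {y = y} (∣⇒≡mod m∣x-y) m∣x = subst (_ ∣_) (x-[x-y]≡y x y) (∣m∣n⇒∣m-n m∣x m∣x-y)
    where
    x-[x-y]≡y : ∀ x y → x - (x - y) ≡ y
    x-[x-y]≡y = solve-∀

  ∣+m-+n∣ : ∀ {m n} → n ≤ m → ∣ + m - + n ∣ ≡ m ℕ.∸ n
  ∣+m-+n∣ {m} {n} n≤m = cong ∣_∣ (trans ([+m]-[+n]≡m⊖n m n) (⊖-≥ n≤m))

  ∣∸-<⇒≡ : ∀ {r s} → r ≤ s → s < m → m ℕ.∣ s ℕ.∸ r → r ≡ s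
  ∣∸-<⇒≡ {m} {r} {s} r≤s s<m m∣s∸r with s ℕ.∸ r in eq
  ... | zero  = ≤-antisym r≤s (m∸n≡0⇒m≤n eq)
  ... | suc _ = contradiction m∣s∸r (ℕ.>⇒∤ (subst (_< m) eq (≤-<-trans (m∸n≤m s r) s<m)))

  <-≡-mod⇒≡ : ∀ {r s} → r < m → s < m → + r ≡ + s mod m → r ≡ s
  <-≡-mod⇒≡ {m} {r} {s} r<m s<m r≡s with ≤-total r s
  ... | inj₁ r≤s = ∣∸-<⇒≡ r≤s s<m (subst (m ℕ.∣_) (∣+m-+n∣ r≤s) (∣⇒∣ᵤ (≡mod⇒∣ (mod-sym r≡s))))
  ... | inj₂ s≤r = sym (∣∸-<⇒≡ s≤r r<m (subst (m ℕ.∣_) (∣+m-+n∣ s≤r) (∣⇒∣ᵤ (≡mod⇒∣ r≡s))))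

  x≡x%ℕm : ∀ x m .{{_ : NonZero m}} → x ≡ + (x %ℕ m) mod m
  x≡x%ℕm x m = ∣⇒≡mod (divides (x /ℕ m) (begin
    x - + (x %ℕ m)                             ≡⟨ cong (_- + (x %ℕ m)) (a≡a%ℕn+[a/ℕn]*n x m) ⟩
    (+ (x %ℕ m) + (x /ℕ m) * + m) - + (x %ℕ m) ≡⟨ +-cancelˡ (+ (x %ℕ m)) ((x /ℕ m) * + m) ⟩
    (x /ℕ m) * + m                             ∎))
    where
    open ≡-Reasoning
    +-cancelˡ : ∀ r q → (r + q) - r ≡ q
    +-cancelˡ = solve-∀

  %ℕ≡⇒≡mod : ∀ .{{_ : NonZero m}} → x %ℕ m ≡ y %ℕ m → x ≡ y mod m
  %ℕ≡⇒≡mod {m} {x} {y} %≡ =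
    mod-trans (x≡x%ℕm x m) (subst (λ r → + r ≡ y mod m) (sym %≡) (mod-sym (x≡x%ℕm y m)))

  ≡mod⇒%ℕ≡ : ∀ .{{_ : NonZero m}} → x ≡ y mod m → x %ℕ m ≡ y %ℕ m
  ≡mod⇒%ℕ≡ {m} {x} {y} x≡y = <-≡-mod⇒≡ (n%ℕd<d x m) (n%ℕd<d y m)
    (mod-trans (mod-sym (x≡x%ℕm x m)) (mod-trans x≡y (x≡x%ℕm y m)))


module ResidueCounting where

  open import Data.Nat as ℕ using (ℕ; suc; pred; _≤_; _*_; NonZero)
  open import Data.Nat.GCD using (gcd; gcd[m,n]∣m; gcd[m,n]∣n; gcd[m,n]≢0; n/gcd[m,n]≢0)
  import Data.Nat.Coprimality as Coprime
  open import Data.Nat.Coprimality using (coprime-/gcd; coprime-divisor)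
  import Data.Nat.Tactic.RingSolver as ℕ-Solver
  import Data.Integer.Tactic.RingSolver as ℤ-Solver
  import Data.Nat.Divisibility as ℕ
  open import Data.Nat.DivMod using (_%_; _/_; m/n*n≡m)
  open import Data.Nat.Properties using (<-≤-trans; *-comm; *-assoc)
  open import Data.Integer as ℤ using (ℤ; +_; _-_; _%ℕ_)
  open import Data.Integer.Properties as ℤ using ([+m]-[+n]≡m⊖n; [1+m]⊖[1+n]≡m⊖n; abs-*)
  open import Data.Integer.DivMod using (n%ℕd<d)
  open import Data.List using (List; length; map)
  open import Data.List.Properties using (length-map)
  open import Data.List.Relation.Unary.All as All using (All)
  import Data.List.Relation.Unary.All.Properties as All
  open import Data.List.Relation.Unary.AllPairs as AllPairs using (AllPairs)
  import Data.List.Relation.Unary.AllPairs.Properties as AllPairs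
  open import Data.List.Relation.Unary.Unique.Propositional using (Unique)
  open import Data.Product using (_×_; _,_)
  open import Relation.Nullary using (¬_)
  open import Data.Integer.Divisibility.Signed using (_∣_; ∣ᵤ⇒∣; ∣⇒∣ᵤ)
  open import Data.Sum using (inj₂)
  open import Relation.Binary.PropositionalEquality using (_≡_; _≢_; sym; trans; cong; subst; subst₂)
  open Counting
  open Congruence

  classesMod-length≤ : ∀ n m K .{{_ : NonZero n}} .{{_ : NonZero m}} → n ℕ.∣ m → m ≤ K * n →
    (ys : List ℤ) → AllPairs (λ y y' → y ≡ y' mod n) ys → AllPairs (λ y y' → ¬ y ≡ y' mod m) ys →
    length ys ≤ K
  classesMod-length≤ n m K n∣m m≤K*n ys same≢ distinct rewrite sym (length-map (_%ℕ m) ys) =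
    sameRemainder-length≤ n K (map (_%ℕ m) ys)
      (AllPairs.map⁺ (AllPairs.map (λ y≢y' %≡ → y≢y' (%ℕ≡⇒≡mod %≡)) distinct))
      (All.map⁺ (All.tabulate (λ {y} _ → <-≤-trans (n%ℕd<d y m) m≤K*n)))
      (AllPairs.map⁺ (AllPairs.map (λ {y} {y'} y≡y' → ≡mod⇒%ℕ≡
        (mod-trans (mod-∣ n∣m (mod-sym (x≡x%ℕm y m))) (mod-trans y≡y' (mod-∣ n∣m (x≡x%ℕm y' m)))))
        same≢))

  window-length≤ : ∀ m N K .{{_ : NonZero m}} → N ≤ K * m → (xs : List ℕ) → Unique xs →
    All (λ x → 1 ≤ x × x ≤ N) xs → AllPairs (λ x x' → + x ≡ + x' mod m) xs → length xs ≤ K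
  window-length≤ m N K N≤K*m xs uniq inWindow same rewrite sym (length-map pred xs) =
    sameRemainder-length≤ m K (map pred xs)
      (AllPairs.map⁺ (AllPairs-weaken pred-injective inWindow uniq))
      (All.map⁺ (All.map (λ { {suc x} (_ , x<N) → <-≤-trans x<N N≤K*m }) inWindow))
      (AllPairs.map⁺ (AllPairs-weaken pred-≡mod inWindow same))
    where
    pred-injective : ∀ {x x'} → 1 ≤ x × x ≤ N → 1 ≤ x' × x' ≤ N → x ≢ x' → pred x ≢ pred x'
    pred-injective {suc x} {suc x'} _ _ x≢x' eq = x≢x' (cong suc eq)
    +[1+u]-+[1+v]≡+u-+v : ∀ u v → + suc u - + suc v ≡ + u - + v
    +[1+u]-+[1+v]≡+u-+v u v = trans ([+m]-[+n]≡m⊖n (suc u) (suc v))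
      (trans ([1+m]⊖[1+n]≡m⊖n u v) (sym ([+m]-[+n]≡m⊖n u v)))
    pred-≡mod : ∀ {x x'} → 1 ≤ x × x ≤ N → 1 ≤ x' × x' ≤ N → + x ≡ + x' mod m →
      pred x % m ≡ pred x' % m
    pred-≡mod {suc x} {suc x'} _ _ (∣⇒≡mod d) =
      ≡mod⇒%ℕ≡ {x = + x} {y = + x'} (∣⇒≡mod (subst (_ ∣_) (+[1+u]-+[1+v]≡+u-+v x x') d))


  ∣*⇒/gcd∣ : ∀ M D {t} .{{_ : NonZero (gcd D M)}} → M ℕ.∣ D * t → M / gcd D M ℕ.∣ t
  ∣*⇒/gcd∣ M D {t} M∣Dt = coprime-divisor (Coprime.sym (coprime-/gcd D M)) (ℕ.*-cancelˡ-∣ g gm∣gd't)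
    where
    g = gcd D M
    gm∣gd't : g * (M / g) ℕ.∣ g * (D / g * t)
    gm∣gd't = subst₂ ℕ._∣_
      (trans (sym (m/n*n≡m (gcd[m,n]∣n D M))) (*-comm (M / g) g))
      (trans (cong (_* t) (trans (sym (m/n*n≡m (gcd[m,n]∣m D M))) (*-comm (D / g) g)))
        (*-assoc g (D / g) t))
      M∣Dt

  window-∣*-length≤ : ∀ M D N K .{{_ : NonZero M}} → N ≤ M * K → (xs : List ℕ) → Unique xs →
    All (λ x → 1 ≤ x × x ≤ N) xs → AllPairs (λ x x' → D ℤ.* + x ≡ D ℤ.* + x' mod M) xs →
    length xs ≤ gcd ℤ.∣ D ∣ M * K
  window-∣*-length≤ M D N K N≤M*K xs uniq inWindow same =
    window-length≤ m N (g * K) {{m≢0}} N≤gK*m xs uniq inWindow (AllPairs.map x≡x'modm same)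
    where
    g = gcd ℤ.∣ D ∣ M
    instance g≢0 : NonZero g
    g≢0 = ℕ.≢-nonZero (gcd[m,n]≢0 ℤ.∣ D ∣ M (inj₂ (ℕ.≢-nonZero⁻¹ M)))
    m = M / g
    m≢0 : NonZero m
    m≢0 = ℕ.≢-nonZero (n/gcd[m,n]≢0 ℤ.∣ D ∣ M)
    N≤gK*m : N ≤ g * K * m
    N≤gK*m = subst (N ≤_)
      (trans (cong (_* K) (sym (m/n*n≡m (gcd[m,n]∣n ℤ.∣ D ∣ M)))) (rearrange m g K)) N≤M*K
      where
      rearrange : ∀ m g K → m * g * K ≡ g * K * m
      rearrange = ℕ-Solver.solve-∀
    x≡x'modm : ∀ {x x'} → D ℤ.* + x ≡ D ℤ.* + x' mod M → + x ≡ + x' mod m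
    x≡x'modm {x} {x'} (∣⇒≡mod M∣Dx-Dx') = ∣⇒≡mod (∣ᵤ⇒∣ (∣*⇒/gcd∣ M ℤ.∣ D ∣ (subst (M ℕ.∣_)
      (trans (cong ℤ.∣_∣ (factor D (+ x) (+ x'))) (abs-* D (+ x ℤ.- + x')))
      (∣⇒∣ᵤ M∣Dx-Dx'))))
      where
      factor : ∀ D x x' → D ℤ.* x ℤ.- D ℤ.* x' ≡ D ℤ.* (x ℤ.- x')
      factor = ℤ-Solver.solve-∀


module PrimeDivisibility where

  open import Data.Nat as ℕ using (ℕ; zero; suc; _^_)
  import Data.Nat.Divisibility as ℕ
  open import Data.Nat.Primality using (Prime; euclidsLemma; prime⇒nonZero; prime⇒nonTrivial)
  open import Data.Nat.Coprimality using (Coprime)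
  open import Data.Integer as ℤ using (ℤ; +_; _*_)
  open import Data.Integer.Properties using (abs-*; pos-*; *-identityʳ; *-comm)
  open import Data.Integer.Divisibility.Signed
    using (_∣_; divides; ∣-refl; ∣-trans; *-monoʳ-∣; *-cancelˡ-∣; ∣ᵤ⇒∣; ∣⇒∣ᵤ)
  open import Data.Sum using (_⊎_; inj₁; inj₂; [_,_]′)
  open import Data.Product using (_,_)
  open import Relation.Nullary using (¬_; contradiction)
  open import Relation.Binary.PropositionalEquality using (_≡_; refl; sym; subst; subst₂)
  open import Data.Integer.Tactic.RingSolver using (solve-∀)
  open import Function using (_∘_)

  private variable
    p : ℕ
    x y : ℤ

  euclidsLemmaℤ : ∀ x y → Prime p → + p ∣ x * y → (+ p ∣ x) ⊎ (+ p ∣ y)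
  euclidsLemmaℤ {p} x y pr p∣xy =
    [ inj₁ ∘ ∣ᵤ⇒∣ , inj₂ ∘ ∣ᵤ⇒∣ ]′
      (euclidsLemma ℤ.∣ x ∣ ℤ.∣ y ∣ pr (subst (p ℕ.∣_) (abs-* x y) (∣⇒∣ᵤ p∣xy)))

  coprime⇒∤ : Prime p → Coprime p ℤ.∣ x ∣ → ¬ + p ∣ x
  coprime⇒∤ pr coprime p∣x =
    ℕ.nonTrivial⇒≢1 {{prime⇒nonTrivial pr}} (coprime (ℕ.∣-refl , ∣⇒∣ᵤ p∣x))

  ∤⇒∤^ : Prime p → ¬ + p ∣ y → ∀ k → ¬ + p ∣ y ℤ.^ k
  ∤⇒∤^ pr p∤y zero p∣1 = ℕ.nonTrivial⇒≢1 {{prime⇒nonTrivial pr}} (ℕ.∣1⇒≡1 (∣⇒∣ᵤ p∣1))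
  ∤⇒∤^ {y = y} pr p∤y (suc k) p∣y^[1+k] =
    [ p∤y , ∤⇒∤^ pr p∤y k ]′ (euclidsLemmaℤ y (y ℤ.^ k) pr p∣y^[1+k])

  p^n∣x*g⇒p^n∣x : ∀ {g} → Prime p → ¬ + p ∣ g → ∀ n {x} → + (p ^ n) ∣ x * g → + (p ^ n) ∣ x
  p^n∣x*g⇒p^n∣x pr p∤g zero {x} _ = divides x (sym (*-identityʳ x))
  p^n∣x*g⇒p^n∣x {p} {g} pr p∤g (suc n) {x} p^[1+n]∣xg
    with euclidsLemmaℤ x g pr (∣-trans (∣ᵤ⇒∣ (ℕ.m∣m*n (p ^ n))) p^[1+n]∣xg)
  ... | inj₂ p∣g = contradiction p∣g p∤g
  ... | inj₁ (divides x′ refl) = subst₂ _∣_ (sym (pos-* p (p ^ n))) (*-comm (+ p) x′)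
          (*-monoʳ-∣ (+ p) (p^n∣x*g⇒p^n∣x pr p∤g n p^n∣x′g))
    where
    instance _ = prime⇒nonZero pr
    p^n∣x′g : + (p ^ n) ∣ x′ * g
    p^n∣x′g = *-cancelˡ-∣ (+ p) (subst₂ _∣_ (pos-* p (p ^ n)) (shuffle x′ (+ p) g) p^[1+n]∣xg)
      where
      shuffle : ∀ a b c → a * b * c ≡ b * (a * c)
      shuffle = solve-∀


module GeometricSum where

  open import Data.Nat as ℕ using (ℕ; zero; suc)
  open import Data.Integer using (ℤ; +_; _+_; _-_; _*_; _^_)
  open import Data.Integer.Properties using (+-inverseʳ; *-zeroʳ)
  open import Data.Integer.Divisibility.Signed using (_∣_; ∣-refl; ∣m∣n⇒∣m+n; ∣n⇒∣m*n; ∣m⇒∣m*n)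
  open import Data.Integer.Tactic.RingSolver using (solve-∀)
  open import Relation.Binary.PropositionalEquality using (_≡_; sym; trans; cong; subst)
  open Congruence

  choose₂ : ℕ → ℕ
  choose₂ zero    = 0
  choose₂ (suc n) = n ℕ.+ choose₂ n

  geomSum : ℕ → ℤ → ℤ → ℤ
  geomSum zero    y y' = + 0
  geomSum (suc m) y y' = y ^ m + y' * geomSum m y y'

  ^-^≡*geomSum : ∀ m y y' → y ^ m - y' ^ m ≡ (y - y') * geomSum m y y'
  ^-^≡*geomSum zero y y' = trans (+-inverseʳ (+ 1)) (sym (*-zeroʳ (y - y')))
  ^-^≡*geomSum (suc m) y y' =
    trans (split y y' (y ^ m) (y' ^ m))
      (trans (cong (λ z → (y - y') * y ^ m + y' * z) (^-^≡*geomSum m y y'))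
        (factor y y' (y ^ m) (geomSum m y y')))
    where
    split : ∀ y y' a b → y * a - y' * b ≡ (y - y') * a + y' * (a - b)
    split = solve-∀
    factor : ∀ y y' a g → (y - y') * a + y' * ((y - y') * g) ≡ (y - y') * (a + y' * g)
    factor = solve-∀

  ≡mod⇒^≡mod : ∀ {q y y'} → y ≡ y' mod q → ∀ k → y ^ k ≡ y' ^ k mod q
  ≡mod⇒^≡mod {y = y} {y'} (∣⇒≡mod q∣y-y') k =
    ∣⇒≡mod (subst (_ ∣_) (sym (^-^≡*geomSum k y y')) (∣m⇒∣m*n (geomSum k y y') q∣y-y'))

  geomSum-≡mod : ∀ {q y y'} → y' ≡ y mod q → ∀ m → geomSum (suc m) y y' ≡ + suc m * y ^ m mod q
  geomSum-≡mod {y = y} {y'} _ zero = subst (λ z → z ≡ _ mod _) (sym (unit y')) (mod-refl (+ 1 * + 1))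
    where
    unit : ∀ y' → + 1 + y' * + 0 ≡ + 1 * + 1
    unit = solve-∀
  geomSum-≡mod {y = y} {y'} y'≡y (suc m) = ∣⇒≡mod (subst (_ ∣_)
    (sym (step y y' (y ^ m) (geomSum (suc m) y y') (+ suc m)))
    (∣m∣n⇒∣m+n (∣n⇒∣m*n y' (≡mod⇒∣ (geomSum-≡mod y'≡y m))) (∣m⇒∣m*n _ (≡mod⇒∣ y'≡y))))
    where
    step : ∀ y y' Y G N → (y * Y + y' * G) - (+ 1 + N) * (y * Y) ≡ y' * (G - N * Y) + (y' - y) * (N * Y)
    step = solve-∀

  -- Second-order expansion of geomSum around y = y'.
  geomSum-≡mod² : ∀ y y' m → (y' - y) * (y' - y) ∣
    y * geomSum m y y' - (+ m * y ^ m + + choose₂ m * y ^ ℕ.pred m * (y' - y))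
  geomSum-≡mod² y y' zero = subst ((y' - y) * (y' - y) ∣_) (sym (base y y')) (∣n⇒∣m*n (+ 0) ∣-refl)
    where
    base : ∀ y y' → y * + 0 - (+ 0 * + 1 + + 0 * + 1 * (y' - y)) ≡ + 0 * ((y' - y) * (y' - y))
    base = solve-∀
  geomSum-≡mod² y y' (suc zero) = subst ((y' - y) * (y' - y) ∣_) (sym (base y y')) (∣n⇒∣m*n (+ 0) ∣-refl)
    where
    base : ∀ y y' →
      y * (+ 1 + y' * + 0) - (+ 1 * (y * + 1) + + 0 * + 1 * (y' - y)) ≡ + 0 * ((y' - y) * (y' - y))
    base = solve-∀
  geomSum-≡mod² y y' (suc (suc m)) = subst ((y' - y) * (y' - y) ∣_)
    (sym (step y y' (y ^ m) (geomSum (suc m) y y') (+ suc m) (+ choose₂ (suc m))))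
    (∣m∣n⇒∣m+n (∣n⇒∣m*n y' (geomSum-≡mod² y y' (suc m))) (∣n⇒∣m*n (+ choose₂ (suc m) * y ^ m) ∣-refl))
    where
    step : ∀ y y' Y G N T →
      y * (y * Y + y' * G) - ((+ 1 + N) * (y * (y * Y)) + (N + T) * (y * Y) * (y' - y))
        ≡ y' * (y * G - (N * (y * Y) + T * Y * (y' - y))) + T * Y * ((y' - y) * (y' - y))
    step = solve-∀


module Lagrange where

  open import Data.Nat as ℕ using (ℕ; zero; suc; _≤_; z≤n; s≤s)
  open import Data.Nat.Primality using (Prime)
  open import Data.Integer using (ℤ; +_; _+_; _-_; _*_; _^_)
  open import Data.Integer.Properties using (*-distribˡ-+; +-inverseʳ; *-zeroʳ)
  open import Data.Integer.Divisibility.Signed using (_∣_; ∣m∣n⇒∣m-n)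
  open import Data.Integer.Tactic.RingSolver using (solve-∀)
  open import Data.List using ([]; _∷_; length)
  open import Data.List.Relation.Unary.All using (All; []; _∷_)
  open import Data.List.Relation.Unary.AllPairs using (AllPairs; []; _∷_)
  open import Data.Product using (∃-syntax; _×_; _,_)
  open import Data.Sum using (inj₁; inj₂)
  open import Relation.Nullary using (¬_; contradiction)
  open import Relation.Binary.PropositionalEquality using (_≡_; refl; sym; trans; cong; cong₂; subst)
  open Congruence
  open GeometricSum
  open PrimeDivisibility

  -- f is a polynomial function of degree ≤ n with coefficient ℓ at yⁿ, described by its
  -- divided differences: each (f y - f r) / (y - r) has degree ≤ n - 1 and the same ℓ.
  IsPolynomial : ℕ → ℤ → (ℤ → ℤ) → Set
  IsPolynomial zero    ℓ f = ∀ y → f y ≡ ℓ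
  IsPolynomial (suc n) ℓ f = ∀ r → ∃[ g ] IsPolynomial n ℓ g × (∀ y → f y - f r ≡ (y - r) * g y)

  IsPolynomial-+ : ∀ n {ℓ ℓ' f g} → IsPolynomial n ℓ f → IsPolynomial n ℓ' g →
    IsPolynomial n (ℓ + ℓ') (λ y → f y + g y)
  IsPolynomial-+ zero F G y = cong₂ _+_ (F y) (G y)
  IsPolynomial-+ (suc n) {f = f} {g} F G r with F r | G r
  ... | f′ , F′ , f-f≡ | g′ , G′ , g-g≡ = (λ y → f′ y + g′ y) , IsPolynomial-+ n F′ G′ , λ y →
    trans (regroup (f y) (f r) (g y) (g r))
      (trans (cong₂ _+_ (f-f≡ y) (g-g≡ y)) (sym (*-distribˡ-+ (y - r) (f′ y) (g′ y))))
    where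
    regroup : ∀ a b c d → (a + c) - (b + d) ≡ (a - b) + (c - d)
    regroup = solve-∀

  IsPolynomial-scale : ∀ n a {ℓ f} → IsPolynomial n ℓ f → IsPolynomial n (a * ℓ) (λ y → a * f y)
  IsPolynomial-scale zero a F y = cong (a *_) (F y)
  IsPolynomial-scale (suc n) a {f = f} F r with F r
  ... | f′ , F′ , f-f≡ = (λ y → a * f′ y) , IsPolynomial-scale n a F′ , λ y →
    trans (factor a (f y) (f r)) (trans (cong (a *_) (f-f≡ y)) (swap a (y - r) (f′ y)))
    where
    factor : ∀ a b c → a * b - a * c ≡ a * (b - c)
    factor = solve-∀
    swap : ∀ a b c → a * (b * c) ≡ b * (a * c)
    swap = solve-∀

  IsPolynomial-raise : ∀ n {ℓ f} → IsPolynomial n ℓ f → IsPolynomial (suc n) (+ 0) f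
  IsPolynomial-raise zero {ℓ} {f} F r = (λ _ → + 0) , (λ _ → refl) , λ y →
    trans (cong₂ _-_ (F y) (F r)) (trans (+-inverseʳ ℓ) (sym (*-zeroʳ (y - r))))
  IsPolynomial-raise (suc n) F r with F r
  ... | f′ , F′ , f-f≡ = f′ , IsPolynomial-raise n F′ , f-f≡

  IsPolynomial-^ : ∀ k → IsPolynomial k (+ 1) (_^ k)
  IsPolynomial-geomSum : ∀ m r → IsPolynomial m (+ 1) (λ y → geomSum (suc m) y r)

  IsPolynomial-^ zero y = refl
  IsPolynomial-^ (suc k) r = (λ y → geomSum (suc k) y r) , IsPolynomial-geomSum k r , λ y →
    ^-^≡*geomSum (suc k) y r

  IsPolynomial-geomSum zero r y = one r
    where
    one : ∀ r → + 1 + r * + 0 ≡ + 1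
    one = solve-∀
  IsPolynomial-geomSum (suc m) r =
    IsPolynomial-+ (suc m) {f = _^ suc m} {g = λ y → r * geomSum (suc m) y r} (IsPolynomial-^ (suc m))
      (IsPolynomial-raise m (IsPolynomial-scale m r (IsPolynomial-geomSum m r)))

  IsPolynomial-const : ∀ n b → IsPolynomial (suc n) (+ 0) (λ _ → b)
  IsPolynomial-const zero    b = IsPolynomial-raise zero {f = λ _ → b} (λ _ → refl)
  IsPolynomial-const (suc n) b = IsPolynomial-raise (suc n) {f = λ _ → b} (IsPolynomial-const n b)

  IsPolynomial-a*y^k+b : ∀ k a b → IsPolynomial (suc k) a (λ y → a * y ^ suc k + b)
  IsPolynomial-a*y^k+b k a b = subst (λ ℓ → IsPolynomial (suc k) ℓ (λ y → a * y ^ suc k + b))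
    (a*1+0≡a a)
    (IsPolynomial-+ (suc k) {f = λ y → a * y ^ suc k} {g = λ _ → b}
      (IsPolynomial-scale (suc k) a (IsPolynomial-^ (suc k))) (IsPolynomial-const k b))
    where
    a*1+0≡a : ∀ a → a * + 1 + + 0 ≡ a
    a*1+0≡a = solve-∀

  lagrange : ∀ {p} → Prime p → ∀ n {ℓ f} → IsPolynomial n ℓ f → ¬ + p ∣ ℓ →
    ∀ ys → AllPairs (λ y y' → ¬ y ≡ y' mod p) ys → All (λ y → + p ∣ f y) ys → length ys ≤ n
  lagrange pr n F p∤ℓ [] _ _ = z≤n
  lagrange pr zero F p∤ℓ (y ∷ _) _ (p∣fy ∷ _) = contradiction (subst (_ ∣_) (F y) p∣fy) p∤ℓ
  lagrange {p} pr (suc n) {f = f} F p∤ℓ (r ∷ ys) (r≢ys ∷ distinct) (p∣fr ∷ p∣fys) with F r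
  ... | g , G , f-f≡ = s≤s (lagrange pr n G p∤ℓ ys distinct (roots-of-g r≢ys p∣fys))
    where
    roots-of-g : ∀ {zs} → All (λ y → ¬ r ≡ y mod p) zs → All (λ y → + p ∣ f y) zs →
      All (λ y → + p ∣ g y) zs
    roots-of-g [] [] = []
    roots-of-g {y ∷ _} (r≢y ∷ r≢zs) (p∣fy ∷ p∣fzs)
      with euclidsLemmaℤ (y - r) (g y) pr (subst (_ ∣_) (f-f≡ y) (∣m∣n⇒∣m-n p∣fy p∣fr))
    ... | inj₁ p∣y-r = contradiction (mod-sym (∣⇒≡mod p∣y-r)) r≢y
    ... | inj₂ p∣gy  = p∣gy ∷ roots-of-g r≢zs p∣fzs


module Lifting where

  open import Data.Nat as ℕ using (ℕ; zero; suc; pred; _≤_; _<_; _∸_; _^_; z≤n; s≤s)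
  import Data.Nat.Divisibility as ℕ
  open import Data.Nat.Properties using (m<m*n; *-monoʳ-≤; *-comm; pred[m∸n]≡m∸[1+n])
  open import Data.Nat.Induction using (<-rec)
  open import Data.Nat.Primality using (Prime; prime⇒nonZero; prime⇒nonTrivial)
  open import Data.Integer as ℤ using (ℤ; +_; _+_; _-_; _*_)
  open import Data.Integer.Properties using (pos-*; ^-*-assoc)
  open import Data.Integer.Divisibility.Signed
    using (_∣_; divides; ∣-refl; ∣-trans; ∣m∣n⇒∣m+n; ∣n⇒∣m*n; ∣m⇒∣m*n;
           *-monoʳ-∣; *-monoˡ-∣; *-cancelˡ-∣; ∣ᵤ⇒∣; ∣⇒∣ᵤ)
  open import Data.Integer.Tactic.RingSolver using (solve-∀)
  open import Data.Product using (∃-syntax; _×_; _,_)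
  open import Data.Sum using ([_,_]′)
  open import Relation.Nullary using (¬_; yes; no; contradiction)
  open import Relation.Binary.PropositionalEquality using (_≡_; sym; trans; cong; subst; subst₂)
  open import Function using (id)
  open Congruence
  open GeometricSum
  open PrimeDivisibility

  private variable
    m p q : ℕ
    y y' : ℤ

  p∤geomSum : Prime p → ¬ + p ∣ + suc m → y' ≡ y mod p → ¬ + p ∣ y → ¬ + p ∣ geomSum (suc m) y y'
  p∤geomSum {m = m} {y = y} pr p∤k y'≡y p∤y p∣G =
    [ p∤k , ∤⇒∤^ pr p∤y m ]′
      (euclidsLemmaℤ (+ suc m) (y ℤ.^ m) pr (∣-respʳ-≡mod (geomSum-≡mod y'≡y m) p∣G))

  -- The hypotheses on q make the second-order term of geomSum-≡mod² vanish mod p².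
  p²∣y*geomSum-p*y^p : Prime p → p ℕ.∣ q → p ℕ.* p ℕ.∣ choose₂ p ℕ.* q → y ≡ y' mod q →
    + p * + p ∣ y * geomSum p y y' - + p * y ℤ.^ p
  p²∣y*geomSum-p*y^p {p} {q} {y} {y'} pr p∣q p²∣C*q y≡y' =
    subst (+ p * + p ∣_) (regroup (y * geomSum p y y') (+ p * y ℤ.^ p) (+ choose₂ p) (y ℤ.^ pred p) t)
      (∣m∣n⇒∣m+n (∣-trans p²∣t² (geomSum-≡mod² y y' p)) (∣n⇒∣m*n (y ℤ.^ pred p) p²∣C*t))
    where
    t = y' - y
    q∣t : + q ∣ t
    q∣t = ≡mod⇒∣ (mod-sym y≡y')
    p∣t : + p ∣ t
    p∣t = ∣-trans (∣ᵤ⇒∣ p∣q) q∣t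
    p²∣t² : + p * + p ∣ t * t
    p²∣t² = ∣-trans (*-monoˡ-∣ (+ p) p∣t) (*-monoʳ-∣ t p∣t)
    p²∣C*t : + p * + p ∣ + choose₂ p * t
    p²∣C*t = ∣-trans (subst₂ _∣_ (pos-* p p) (pos-* (choose₂ p) q) (∣ᵤ⇒∣ p²∣C*q))
      (*-monoʳ-∣ (+ choose₂ p) q∣t)
    regroup : ∀ G P C Y t → (G - (P + C * Y * t)) + Y * (C * t) ≡ G - P
    regroup = solve-∀

  geomSum-p : Prime p → p ℕ.∣ q → p ℕ.* p ℕ.∣ choose₂ p ℕ.* q → y ≡ y' mod q → ¬ + p ∣ y →
    ∃[ u ] geomSum p y y' ≡ u * + p × ¬ + p ∣ u
  geomSum-p {p} {q} {y} {y'} pr p∣q p²∣C*q y≡y' p∤y = u , G≡u*p , p∤u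
    where
    instance _ = prime⇒nonZero pr
    p²∣yG-py^p : + p * + p ∣ y * geomSum p y y' - + p * y ℤ.^ p
    p²∣yG-py^p = p²∣y*geomSum-p*y^p pr p∣q p²∣C*q y≡y'
    p∣yG : + p ∣ y * geomSum p y y'
    p∣yG = ∣-respʳ-≡mod (mod-sym (∣⇒≡mod (∣-trans (∣m⇒∣m*n (+ p) ∣-refl) p²∣yG-py^p)))
      (∣m⇒∣m*n (y ℤ.^ p) ∣-refl)
    p∣G : + p ∣ geomSum p y y'
    p∣G = [ (λ p∣y → contradiction p∣y p∤y) , id ]′ (euclidsLemmaℤ y (geomSum p y y') pr p∣yG)
    u : ℤ
    u = _∣_.quotient p∣G
    G≡u*p : geomSum p y y' ≡ u * + p
    G≡u*p = _∣_.equality p∣G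
    p∣yu-y^p : + p ∣ y * u - y ℤ.^ p
    p∣yu-y^p = *-cancelˡ-∣ (+ p) (subst (+ p * + p ∣_)
      (trans (cong (λ G → y * G - + p * y ℤ.^ p) G≡u*p) (factor y u (+ p) (y ℤ.^ p)))
      p²∣yG-py^p)
      where
      factor : ∀ y u p Y → y * (u * p) - p * Y ≡ p * (y * u - Y)
      factor = solve-∀
    p∤u : ¬ + p ∣ u
    p∤u p∣u = ∤⇒∤^ pr p∤y p (∣-respʳ-≡mod (∣⇒≡mod p∣yu-y^p) (∣n⇒∣m*n y p∣u))

  lift-∤ : Prime p → ¬ + p ∣ + suc m → y ≡ y' mod p → ¬ + p ∣ y →
    ∀ n → y ℤ.^ suc m ≡ y' ℤ.^ suc m mod p ^ n → y ≡ y' mod p ^ n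
  lift-∤ {m = m} {y = y} {y'} pr p∤k y≡y' p∤y n (∣⇒≡mod p^n∣y^k-y'^k) = ∣⇒≡mod
    (p^n∣x*g⇒p^n∣x pr (p∤geomSum pr p∤k (mod-sym y≡y') p∤y) n
      (subst (_ ∣_) (^-^≡*geomSum (suc m) y y') p^n∣y^k-y'^k))

  lift-p : Prime p → p ℕ.∣ q → p ℕ.* p ℕ.∣ choose₂ p ℕ.* q → y ≡ y' mod q → ¬ + p ∣ y →
    ∀ n → y ℤ.^ p ≡ y' ℤ.^ p mod p ^ n → y ≡ y' mod p ^ pred n
  lift-p {y = y} {y'} _ _ _ _ _ zero _ = mod-1 y y'
  lift-p {p} {y = y} {y'} pr p∣q p²∣C*q y≡y' p∤y (suc n) (∣⇒≡mod p^[1+n]∣y^p-y'^p) =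
    cancel-p (geomSum-p pr p∣q p²∣C*q y≡y' p∤y)
    where
    instance _ = prime⇒nonZero pr
    cancel-p : ∃[ u ] geomSum p y y' ≡ u * + p × ¬ + p ∣ u → y ≡ y' mod p ^ n
    cancel-p (u , G≡u*p , p∤u) = ∣⇒≡mod (p^n∣x*g⇒p^n∣x pr p∤u n (*-cancelˡ-∣ (+ p)
      (subst₂ _∣_ (pos-* p (p ^ n)) y^p-y'^p≡ p^[1+n]∣y^p-y'^p)))
      where
      swap : ∀ a u p → a * (u * p) ≡ p * (a * u)
      swap = solve-∀
      y^p-y'^p≡ : y ℤ.^ p - y' ℤ.^ p ≡ + p * ((y - y') * u)
      y^p-y'^p≡ = trans (^-^≡*geomSum p y y') (trans (cong ((y - y') *_) G≡u*p) (swap (y - y') u (+ p)))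

  LosesAtMost : (p q k w : ℕ) → Set
  LosesAtMost p q k w = ∀ {y y'} n → y ≡ y' mod q → ¬ + p ∣ y →
    y ℤ.^ k ≡ y' ℤ.^ k mod p ^ n → y ≡ y' mod p ^ (n ∸ w)

  PowerLift : (p q k : ℕ) → Set
  PowerLift p q k = ∃[ w ] p ^ w ≤ k × LosesAtMost p q k w

  PowerLift-∤ : Prime p → p ℕ.∣ q → ∀ {k} → ¬ p ℕ.∣ suc k → PowerLift p q (suc k)
  PowerLift-∤ pr p∣q p∤k = 0 , s≤s z≤n , λ n y≡y' p∤y →
    lift-∤ pr (λ p∣k → p∤k (∣⇒∣ᵤ p∣k)) (mod-∣ p∣q y≡y') p∤y n

  PowerLift-p* : Prime p → p ℕ.∣ q → p ℕ.* p ℕ.∣ choose₂ p ℕ.* q →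
    ∀ {k} → PowerLift p q k → PowerLift p q (p ℕ.* k)
  PowerLift-p* {p} {q} pr p∣q p²∣C*q {k} (w , p^w≤k , loses) = suc w , *-monoʳ-≤ p p^w≤k , loses′
    where
    loses′ : LosesAtMost p q (p ℕ.* k) (suc w)
    loses′ {y} {y'} n y≡y' p∤y y^pk≡y'^pk =
      subst (λ e → y ≡ y' mod p ^ e) (pred[m∸n]≡m∸[1+n] n w)
        (lift-p pr p∣q p²∣C*q y≡y' p∤y (n ∸ w)
          (loses n (≡mod⇒^≡mod y≡y' p) (∤⇒∤^ pr p∤y p)
            (subst₂ (λ a b → a ≡ b mod p ^ n) (sym (^-*-assoc y p k)) (sym (^-*-assoc y' p k))
              y^pk≡y'^pk)))

  powerLift : Prime p → p ℕ.∣ q → p ℕ.* p ℕ.∣ choose₂ p ℕ.* q → ∀ k → 1 ≤ k → PowerLift p q k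
  powerLift {p} {q} pr p∣q p²∣C*q = <-rec (λ k → 1 ≤ k → PowerLift p q k) lift
    where
    lift : ∀ k → (∀ {k'} → k' < k → 1 ≤ k' → PowerLift p q k') → 1 ≤ k → PowerLift p q k
    lift (suc m) rec _ with p ℕ.∣? suc m
    ... | no p∤k = PowerLift-∤ pr p∣q p∤k
    ... | yes (ℕ.divides zero ())
    ... | yes (ℕ.divides k'@(suc _) k≡k'p) = subst (PowerLift p q) k'p≡k
      (PowerLift-p* pr p∣q p²∣C*q (rec k'<k (s≤s z≤n)))
      where
      k'p≡k : p ℕ.* k' ≡ suc m
      k'p≡k = trans (*-comm p k') (sym k≡k'p)
      k'<k : k' < suc m
      k'<k = subst (k' <_) (sym k≡k'p) (m<m*n k' p (ℕ.nonTrivial⇒n>1 p {{prime⇒nonTrivial pr}}))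


module RootCount where

  open import Data.Nat as ℕ using (ℕ; zero; suc; pred; _≤_; _∸_; _^_; z≤n; s≤s; NonZero)
  import Data.Nat.Divisibility as ℕ
  open import Data.Nat.Properties as ℕ
    using (≤-antisym; ≤-trans; ≤-refl; *-monoˡ-≤; ^-monoʳ-≤; ^-distribˡ-+-*; m≤n+m∸n;
           m+[n∸m]≡n; m∸n≤m; m^n≢0; _≟_)
  import Data.Nat.Tactic.RingSolver as ℕ-Solver
  open import Data.Nat.Primality using (Prime; euclidsLemma; prime⇒nonZero; prime⇒nonTrivial)
  open import Data.Integer as ℤ using (ℤ; +_; _+_; _-_; _*_; _%ℕ_)
  open import Data.Integer.DivMod using (n%ℕd<d)
  open import Data.Integer.Divisibility.Signed
    using (_∣_; divides; ∣-refl; ∣-trans; ∣m∣n⇒∣m-n; ∣m+n∣m⇒∣n; ∣n⇒∣m*n; ∣m⇒∣m*n; ∣ᵤ⇒∣)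
  open import Data.Integer.Tactic.RingSolver using (solve-∀)
  open import Data.List using (List; []; _∷_; length)
  open import Data.List.Relation.Unary.All as All using (All; []; _∷_)
  open import Data.List.Relation.Unary.AllPairs using (AllPairs; []; _∷_)
  open import Data.Product using (_×_; _,_; proj₂)
  open import Data.Sum using (inj₁; inj₂)
  open import Relation.Nullary using (¬_; yes; no; contradiction)
  open import Relation.Binary.PropositionalEquality
    using (_≡_; _≢_; refl; sym; trans; cong; subst; module ≡-Reasoning)
  open Counting
  open Congruence
  open ResidueCounting
  open PrimeDivisibility
  open GeometricSum
  open Lagrange
  open Lifting

  private variable
    p : ℕ

  2*choose₂n≡n*[n-1] : ∀ n → 2 ℕ.* choose₂ n ≡ n ℕ.* pred n
  2*choose₂n≡n*[n-1] zero = refl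
  2*choose₂n≡n*[n-1] (suc zero) = refl
  2*choose₂n≡n*[n-1] (suc (suc n)) = begin
    2 ℕ.* (suc n ℕ.+ choose₂ (suc n))        ≡⟨ ℕ.*-distribˡ-+ 2 (suc n) (choose₂ (suc n)) ⟩
    2 ℕ.* suc n ℕ.+ 2 ℕ.* choose₂ (suc n)    ≡⟨ cong (2 ℕ.* suc n ℕ.+_) (2*choose₂n≡n*[n-1] (suc n)) ⟩
    2 ℕ.* suc n ℕ.+ suc n ℕ.* n             ≡⟨ expand n ⟩
    suc (suc n) ℕ.* suc n                   ∎
    where
    open ≡-Reasoning
    expand : ∀ n → 2 ℕ.* suc n ℕ.+ suc n ℕ.* n ≡ suc (suc n) ℕ.* suc n
    expand = ℕ-Solver.solve-∀

  p∣choose₂p : Prime p → p ≢ 2 → p ℕ.∣ choose₂ p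
  p∣choose₂p {p} pr p≢2
    with euclidsLemma 2 (choose₂ p) pr (subst (p ℕ.∣_) (sym (2*choose₂n≡n*[n-1] p)) (ℕ.m∣m*n (pred p)))
  ... | inj₂ p∣choose₂p = p∣choose₂p
  ... | inj₁ p∣2 =
    contradiction (≤-antisym (ℕ.∣⇒≤ p∣2) (ℕ.nonTrivial⇒n>1 p {{prime⇒nonTrivial pr}})) p≢2

  p^m∣p^n : ∀ p {m n} → m ≤ n → p ^ m ℕ.∣ p ^ n
  p^m∣p^n p {m} {n} m≤n = ℕ.divides (p ^ (n ∸ m)) (begin
    p ^ n                   ≡⟨ cong (p ^_) (m+[n∸m]≡n m≤n) ⟨
    p ^ (m ℕ.+ (n ∸ m))     ≡⟨ ^-distribˡ-+-* p m (n ∸ m) ⟩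
    p ^ m ℕ.* p ^ (n ∸ m)   ≡⟨ ℕ.*-comm (p ^ m) (p ^ (n ∸ m)) ⟩
    p ^ (n ∸ m) ℕ.* p ^ m   ∎)
    where open ≡-Reasoning

  p^l≤p^w*p^[l∸w] : ∀ p .{{_ : NonZero p}} l w → p ^ l ≤ p ^ w ℕ.* p ^ (l ∸ w)
  p^l≤p^w*p^[l∸w] p l w = subst (p ^ l ≤_) (^-distribˡ-+-* p w (l ∸ w)) (^-monoʳ-≤ p (m≤n+m∸n l w))

  odd⇒%ℕ2≡1 : ∀ {y} → ¬ + 2 ∣ y → y %ℕ 2 ≡ 1
  odd⇒%ℕ2≡1 {y} 2∤y with y %ℕ 2 in eq | n%ℕd<d y 2
  ... | 0 | _ = contradiction (∣-respʳ-≡mod (mod-sym y≡0) (divides (+ 0) refl)) 2∤y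
    where
    y≡0 : y ≡ + 0 mod 2
    y≡0 = subst (λ r → y ≡ + r mod 2) eq (x≡x%ℕm y 2)
  ... | 1 | _ = refl
  ... | suc (suc _) | s≤s (s≤s ())

  oddClasses-length≤ : ∀ ys → All (λ y → ¬ + 2 ∣ y) ys → AllPairs (λ y y' → ¬ y ≡ y' mod 4) ys →
    length ys ≤ 2
  oddClasses-length≤ ys odd distinct = classesMod-length≤ 2 4 2 (ℕ.divides 2 refl) ≤-refl ys
    (AllPairs-weaken (λ 2∤y 2∤y' _ → %ℕ≡⇒≡mod (trans (odd⇒%ℕ2≡1 2∤y) (sym (odd⇒%ℕ2≡1 2∤y'))))
      odd distinct)
    distinct

  distinctMod1-length≤1 : ∀ (ys : List ℤ) → AllPairs (λ y y' → ¬ y ≡ y' mod 1) ys → length ys ≤ 1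
  distinctMod1-length≤1 [] _ = z≤n
  distinctMod1-length≤1 (_ ∷ []) _ = s≤s z≤n
  distinctMod1-length≤1 (y ∷ y' ∷ _) ((y≢y' ∷ _) ∷ _) = contradiction (mod-1 y y') y≢y'

  module _ (a b : ℤ) where

    IsUnitRoot : (p k l : ℕ) → ℤ → Set
    IsUnitRoot p k l y = (+ (p ^ l) ∣ a * y ℤ.^ k + b) × ¬ + p ∣ y

    roots⇒^≡mod : Prime p → ¬ + p ∣ a → ∀ {k l y y'} →
      + (p ^ l) ∣ a * y ℤ.^ k + b → + (p ^ l) ∣ a * y' ℤ.^ k + b → y ℤ.^ k ≡ y' ℤ.^ k mod p ^ l
    roots⇒^≡mod pr p∤a {k} {l} {y} {y'} root root' = ∣⇒≡mod (p^n∣x*g⇒p^n∣x pr p∤a l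
      (subst (_ ∣_) (difference a (y ℤ.^ k) (y' ℤ.^ k) b) (∣m∣n⇒∣m-n root root')))
      where
      difference : ∀ a Y Y' b → (a * Y + b) - (a * Y' + b) ≡ (Y - Y') * a
      difference = solve-∀

    root⇒unit : Prime p → ¬ + p ∣ b → ∀ {k l y} → + (p ^ suc l) ∣ a * y ℤ.^ suc k + b → ¬ + p ∣ y
    root⇒unit {p} pr p∤b {k} {l} {y} root p∣y =
      p∤b (∣m+n∣m⇒∣n (∣-trans (∣ᵤ⇒∣ (ℕ.m∣m*n (p ^ l))) root) (∣n⇒∣m*n a (∣m⇒∣m*n (y ℤ.^ k) p∣y)))

    rootsInClass-length≤ : Prime p → ¬ + p ∣ a → ∀ {q k} → PowerLift p q k → ∀ l ys →
      All (IsUnitRoot p k l) ys → AllPairs (λ y y' → ¬ y ≡ y' mod p ^ l) ys →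
      AllPairs (λ y y' → y ≡ y' mod q) ys → length ys ≤ k
    rootsInClass-length≤ {p} pr p∤a {k = k} (w , p^w≤k , loses) l ys roots distinct sameClass =
      ≤-trans (classesMod-length≤ (p ^ (l ∸ w)) (p ^ l) (p ^ w) {{m^n≢0 p (l ∸ w)}} {{m^n≢0 p l}}
                 (p^m∣p^n p (m∸n≤m l w)) (p^l≤p^w*p^[l∸w] p l w) ys sameFinerClass distinct)
              p^w≤k
      where
      instance _ = prime⇒nonZero pr
      sameFinerClass : AllPairs (λ y y' → y ≡ y' mod p ^ (l ∸ w)) ys
      sameFinerClass = AllPairs-weaken (λ (root , p∤y) (root' , _) y≡y' →
        loses l y≡y' p∤y (roots⇒^≡mod pr p∤a {k} {l} root root')) roots sameClass

    -- Classes mod q, with q = 4 if p = 2 and q = p otherwise: at most 2 (odd residues mod 4)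
    -- resp. k (Lagrange) of them occur, and each holds at most k roots (powerLift).
    unitRoots-length≤ : Prime p → ¬ + p ∣ a → ∀ k l ys → All (IsUnitRoot p (suc k) (suc l)) ys →
      AllPairs (λ y y' → ¬ y ≡ y' mod p ^ suc l) ys → length ys ≤ 2 ℕ.* suc k ℕ.* suc k
    unitRoots-length≤ {p} pr p∤a k l ys unitRoots distinct with p ≟ 2
    ... | yes refl = ≤-trans
      (length≤classes*classSize (λ y y' → y ≡? y' mod 4) mod-isPartialEquivalence 2 (suc k)
        (λ zs units → oddClasses-length≤ zs (All.map proj₂ units))
        (rootsInClass-length≤ pr p∤a (powerLift pr (ℕ.divides 2 refl) ℕ.∣-refl (suc k) (s≤s z≤n))
          (suc l))
        ys unitRoots distinct)
      (*-monoˡ-≤ (suc k) (ℕ.m≤m*n 2 (suc k)))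
    ... | no p≢2 = ≤-trans
      (length≤classes*classSize (λ y y' → y ≡? y' mod p) mod-isPartialEquivalence (suc k) (suc k)
        (λ zs units distinct′ → lagrange pr (suc k) (IsPolynomial-a*y^k+b k a b) p∤a zs distinct′
          (All.map (λ (root , _) → ∣-trans (∣ᵤ⇒∣ (ℕ.m∣m*n (p ^ l))) root) units))
        (rootsInClass-length≤ pr p∤a (powerLift pr ℕ.∣-refl p²∣C*p (suc k) (s≤s z≤n)) (suc l))
        ys unitRoots distinct)
      (*-monoˡ-≤ (suc k) (ℕ.m≤n*m (suc k) 2))
      where
      p²∣C*p : p ℕ.* p ℕ.∣ choose₂ p ℕ.* p
      p²∣C*p = ℕ.*-monoˡ-∣ p (p∣choose₂p pr p≢2)

    roots-length≤ : Prime p → ¬ + p ∣ a → ¬ + p ∣ b → ∀ k l ys →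
      All (λ y → + (p ^ l) ∣ a * y ℤ.^ suc k + b) ys →
      AllPairs (λ y y' → ¬ y ≡ y' mod p ^ l) ys → length ys ≤ 2 ℕ.* suc k ℕ.* suc k
    roots-length≤ pr p∤a p∤b k zero ys _ distinct =
      ≤-trans (distinctMod1-length≤1 ys distinct) (s≤s z≤n)
    roots-length≤ pr p∤a p∤b k (suc l) ys roots distinct =
      unitRoots-length≤ pr p∤a k l ys (All.map (λ root → root , root⇒unit pr p∤b {k} {l} root) roots)
        distinct


module Solutions where

  open import Defs
  open import Data.Nat as ℕ using (ℕ; suc; _≤_; _^_; _∸_; _⊔_)
  open import Data.Nat.GCD using (gcd)
  open import Data.Nat.Primality using (Prime; prime⇒nonZero)
  open import Data.List using (length)
  open import Data.List.Relation.Unary.All as All using (All)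
  open import Data.List.Relation.Unary.AllPairs as AllPairs using (AllPairs)
  open import Data.List.Relation.Unary.Unique.Propositional using (Unique)
  open import Relation.Nullary using (¬_; Dec)
  import Data.Nat.Properties as ℕ
  open import Data.Integer as ℤ using (ℤ; +_)
  import Data.Integer.Properties as ℤ
  open import Data.Integer.Divisibility.Signed using (_∣_; *-monoʳ-∣; ∣ᵤ⇒∣)
  import Data.Integer.Tactic.RingSolver as ℤ-Solver
  open import Data.Product using (_×_; _,_; proj₁)
  open import Relation.Binary using (IsEquivalence; IsPartialEquivalence)
  import Relation.Binary.Construct.On as On
  open import Relation.Binary.PropositionalEquality
    using (_≡_; sym; trans; cong; cong₂; subst; subst₂; module ≡-Reasoning)
  open Counting
  open Congruence
  open ResidueCounting
  open RootCount

  module _ (p : ℕ) (a b c d : ℤ) (l i : ℕ) where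

    -- As p^i y = c + d x, this says that the quotients y, y' of x, x' agree mod p^l.
    SameQuotient : ℕ → ℕ → Set
    SameQuotient x x' = d ℤ.* + x ≡ d ℤ.* + x' mod p ^ (i ℕ.+ l)

    SameQuotient-isPartialEquivalence : IsPartialEquivalence SameQuotient
    SameQuotient-isPartialEquivalence =
      IsEquivalence.isPartialEquivalence (On.isEquivalence (λ x → d ℤ.* + x) mod-isEquivalence)

    sameQuotient? : ∀ x x' → Dec (SameQuotient x x')
    sameQuotient? x x' = d ℤ.* + x ≡? d ℤ.* + x' mod p ^ (i ℕ.+ l)

    quotient : ∀ k {x} → Sat p a b c d l i k x → ℤ
    quotient k = proj₁

    quotient-≡mod⇒SameQuotient : ∀ k {x x'} (s : Sat p a b c d l i k x) (s' : Sat p a b c d l i k x') →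
      quotient k s ≡ quotient k s' mod p ^ l → SameQuotient x x'
    quotient-≡mod⇒SameQuotient k {x} {x'} (y , c+dx≡p^iy , _) (y' , c+dx'≡p^iy' , _) (∣⇒≡mod p^l∣y-y') =
      ∣⇒≡mod (subst₂ _∣_ p^i*p^l≡p^[i+l] dx-dx'≡ (*-monoʳ-∣ (+ (p ^ i)) p^l∣y-y'))
      where
      p^i*p^l≡p^[i+l] : + (p ^ i) ℤ.* + (p ^ l) ≡ + (p ^ (i ℕ.+ l))
      p^i*p^l≡p^[i+l] = trans (sym (ℤ.pos-* (p ^ i) (p ^ l))) (cong +_ (sym (ℕ.^-distribˡ-+-* p i l)))
      dx-dx'≡ : + (p ^ i) ℤ.* (y ℤ.- y') ≡ d ℤ.* + x ℤ.- d ℤ.* + x'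
      dx-dx'≡ = begin
        + (p ^ i) ℤ.* (y ℤ.- y')                     ≡⟨ distrib (+ (p ^ i)) y y' ⟩
        + (p ^ i) ℤ.* y ℤ.- + (p ^ i) ℤ.* y'          ≡⟨ cong₂ ℤ._-_ c+dx≡p^iy c+dx'≡p^iy' ⟨
        (c ℤ.+ d ℤ.* + x) ℤ.- (c ℤ.+ d ℤ.* + x')     ≡⟨ cancel c (d ℤ.* + x) (d ℤ.* + x') ⟩
        d ℤ.* + x ℤ.- d ℤ.* + x'                     ∎
        where
        open ≡-Reasoning
        distrib : ∀ P y y' → P ℤ.* (y ℤ.- y') ≡ P ℤ.* y ℤ.- P ℤ.* y'
        distrib = ℤ-Solver.solve-∀
        cancel : ∀ c u v → (c ℤ.+ u) ℤ.- (c ℤ.+ v) ≡ u ℤ.- v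
        cancel = ℤ-Solver.solve-∀

    distinctQuotients-length≤ : Prime p → ¬ + p ∣ a → ¬ + p ∣ b →
      ∀ k {xs} (sols : All (Sat p a b c d l i (suc k)) xs) →
      AllPairs (λ x x' → ¬ SameQuotient x x') xs → length xs ≤ 2 ℕ.* suc k ℕ.* suc k
    distinctQuotients-length≤ pr p∤a p∤b k sols distinct =
      subst (_≤ 2 ℕ.* suc k ℕ.* suc k) (length-reduce (quotient (suc k)) sols)
        (roots-length≤ a b pr p∤a p∤b k l (All.reduce (quotient (suc k)) sols)
          (All-reduce⁺ (quotient (suc k)) (λ (_ , _ , root) → ∣ᵤ⇒∣ root) sols)
          (AllPairs-reduce⁺ (quotient (suc k))
            (λ s s' ¬same y≡y' → ¬same (quotient-≡mod⇒SameQuotient (suc k) s s' y≡y')) sols distinct))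

    sameQuotient-length≤ : Prime p → ∀ k h {xs} → Unique xs →
      All (λ x → 1 ≤ x × x ≤ p ^ h × Sat p a b c d l i k x) xs → AllPairs SameQuotient xs →
      length xs ≤ gcd ℤ.∣ d ∣ (p ^ l) ℕ.* (1 ⊔ p ^ (h ∸ l))
    sameQuotient-length≤ pr k h {xs} uniq sols same =
      window-∣*-length≤ (p ^ l) d (p ^ h) (1 ⊔ p ^ (h ∸ l)) {{ℕ.m^n≢0 p l}} p^h≤p^l*[1⊔p^[h∸l]] xs uniq
        (All.map (λ (1≤x , x≤p^h , _) → 1≤x , x≤p^h) sols)
        (AllPairs.map (mod-∣ (p^m∣p^n p (ℕ.m≤n+m l i))) same)
      where
      instance _ = prime⇒nonZero pr
      p^h≤p^l*[1⊔p^[h∸l]] : p ^ h ≤ p ^ l ℕ.* (1 ⊔ p ^ (h ∸ l))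
      p^h≤p^l*[1⊔p^[h∸l]] = begin
        p ^ h                    ≤⟨ ℕ.^-monoʳ-≤ p (ℕ.m≤n+m∸n h l) ⟩
        p ^ (l ℕ.+ (h ∸ l))      ≡⟨ ℕ.^-distribˡ-+-* p l (h ∸ l) ⟩
        p ^ l ℕ.* p ^ (h ∸ l)    ≤⟨ ℕ.*-monoʳ-≤ (p ^ l) (ℕ.m≤n⊔m 1 (p ^ (h ∸ l))) ⟩
        p ^ l ℕ.* (1 ⊔ p ^ (h ∸ l)) ∎
        where open ℕ.≤-Reasoning


open import Defs
open import Data.Nat using (ℕ; _≤_; _*_; _^_; _∸_; _⊔_)
open import Data.Integer using (ℤ; ∣_∣)
open import Data.Nat.GCD using (gcd)
open import Data.Nat.Primality using (Prime)
open import Data.Nat.Coprimality using (Coprime)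
open import Data.List using (List; length)
open import Data.List.Relation.Unary.All using (All)
open import Data.List.Relation.Unary.Unique.Propositional using (Unique)
open import Data.Product using (∃-syntax; _×_)

open import Data.Nat using (suc)
open import Data.Nat.Properties using (*-assoc; module ≤-Reasoning)
import Data.List.Relation.Unary.All as All
open import Data.Product using (_,_; proj₂)
open import Function using (_∘_)
open Counting using (length≤classes*classSize)
open PrimeDivisibility using (coprime⇒∤)
open Solutions

lemma16 : (k : ℕ) → 1 ≤ k →
    ∃[ C ] ((p : ℕ) (a b c d : ℤ) (l h i : ℕ) →
      Prime p → Coprime p ∣ a ∣ → Coprime p ∣ b ∣ →
      (xs : List ℕ) → Unique xs →
      All (λ x → 1 ≤ x × x ≤ p ^ h × Sat p a b c d l i k x) xs →
      length xs ≤ C * gcd ∣ d ∣ (p ^ l) * (1 ⊔ p ^ (h ∸ l)))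
lemma16 (suc k) _ = R , λ p a b c d l h i pr p⊥a p⊥b xs uniq sols → begin
  length xs
    ≤⟨ length≤classes*classSize
         (sameQuotient? p a b c d l i) (SameQuotient-isPartialEquivalence p a b c d l i)
         R (gcd ∣ d ∣ (p ^ l) * (1 ⊔ p ^ (h ∸ l)))
         (λ _ sols′ → distinctQuotients-length≤ p a b c d l i pr (coprime⇒∤ pr p⊥a) (coprime⇒∤ pr p⊥b) k
                        (All.map (proj₂ ∘ proj₂) sols′))
         (λ _ sols′ uniq′ → sameQuotient-length≤ p a b c d l i pr (suc k) h uniq′ sols′)
         xs sols uniq ⟩
  R * (gcd ∣ d ∣ (p ^ l) * (1 ⊔ p ^ (h ∸ l)))
    ≡⟨ *-assoc R (gcd ∣ d ∣ (p ^ l)) (1 ⊔ p ^ (h ∸ l)) ⟨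
  R * gcd ∣ d ∣ (p ^ l) * (1 ⊔ p ^ (h ∸ l)) ∎
  where
  open ≤-Reasoning
  R = 2 * suc k * suc k
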